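{- Let $X$ be a set with a ternary relation $R$, let $E\subseteq X$, and let $(Q,\le,\bullet)$ be a prequantale with least element $0$ and an element $1\in Q$. Let $\ast$ be the convolution on $Q^X$ and $\mathit{id}_E(x)=1$ if $x\in E$, $0$ otherwise. (1) If $E$ is a set of relational units for $R$ and $1$ is a two-sided unit of $\bullet$, then $\mathit{id}_E$ is a two-sided unit of $\ast$. (2) If $1$ is a two-sided unit of $\bullet$, $1\neq 0$, and $\mathit{id}_E$ is a two-sided unit of $\ast$, then $E$ is a set of relational units for $R$. (3) If $E\neq\emptyset$ and $\mathit{id}_E$ is a two-sided unit of $\ast$, then $1$ is a two-sided unit of $\bullet$.
   Context: $R^x_{yz}$ means $R$ holds at $(x,y,z)$. A prequantale is a complete lattice $(Q,\le)$ with a binary operation $\bullet$ preserving arbitrary sups (including empty sups) in both arguments. Convolution: $(f\ast g)(x)=\bigvee\{f(y)\bullet g(z)\mid R^x_{yz}\}$ for $f,g:X\to Q$. $E$ is a set of relational units for $R$ if for all $x,y\in X$: $\exists e\in E.\ R^x_{ex}$; $R^x_{ey}\wedge e\in E\Rightarrow x=y$; $\exists e\in E.\ R^x_{xe}$; $R^x_{ye}\wedge e\in E\Rightarrow x=y$. -}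

module Defs where

open import Level using (Level; Lift; lift) renaming (suc to lsuc)
open import Data.Bool using (Bool; true; false; if_then_else_)
open import Data.Empty using (⊥)
open import Data.Product using (Σ; ∃; _×_; _,_)
open import Relation.Binary.PropositionalEquality using (_≡_)
open import Relation.Binary.Structures using (IsPartialOrder)

-- A prequantale: a complete lattice (Q, ≤) (every family indexed by a
-- type in the universe has a supremum; subsets of Q are such families)
-- with a binary operation • preserving all sups (incl. empty) in each
-- argument.
record Prequantale (ℓ : Level) : Set (lsuc ℓ) where
  infixl 7 _•_
  field
    Carrier        : Set ℓ
    _≤_            : Carrier → Carrier → Set ℓ
    isPartialOrder : IsPartialOrder _≡_ _≤_
    ⋁              : {I : Set ℓ} → (I → Carrier) → Carrier
    ⋁-upper        : {I : Set ℓ} (f : I → Carrier) (i : I) → f i ≤ ⋁ f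
    ⋁-least        : {I : Set ℓ} (f : I → Carrier) (b : Carrier) →
                     (∀ i → f i ≤ b) → ⋁ f ≤ b
    _•_            : Carrier → Carrier → Carrier
    •-⋁ˡ           : {I : Set ℓ} (f : I → Carrier) (b : Carrier) →
                     (⋁ f) • b ≡ ⋁ (λ i → f i • b)
    •-⋁ʳ           : {I : Set ℓ} (a : Carrier) (f : I → Carrier) →
                     a • (⋁ f) ≡ ⋁ (λ i → a • f i)

  𝟘 : Carrier
  𝟘 = ⋁ {Lift ℓ ⊥} (λ ())

module _ {ℓ : Level} (Q : Prequantale ℓ) where
  open Prequantale Q

  IsTwoSidedUnit : Carrier → Set ℓ
  IsTwoSidedUnit u = ∀ a → (u • a ≡ a) × (a • u ≡ a)

  -- R x y z  means  R^x_{yz}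
  module _ {X : Set ℓ} (R : X → X → X → Set ℓ) where

    conv : (X → Carrier) → (X → Carrier) → X → Carrier
    conv f g x = ⋁ {Σ (X × X) (λ { (y , z) → R x y z })}
                   (λ { ((y , z) , _) → f y • g z })

    IsConvUnit : (X → Carrier) → Set ℓ
    IsConvUnit i = ∀ (f : X → Carrier) (x : X) →
                   (conv f i x ≡ f x) × (conv i f x ≡ f x)

  idE : {X : Set ℓ} → (X → Bool) → Carrier → X → Carrier
  idE E u x = if E x then u else 𝟘

record RelationalUnits {ℓ : Level} {X : Set ℓ} (R : X → X → X → Set ℓ)
                       (E : X → Bool) : Set ℓ where
  field
    left-exists  : ∀ x → ∃ λ e → (E e ≡ true) × R x e x
    left-unique  : ∀ x y e → E e ≡ true → R x e y → x ≡ y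
    right-exists : ∀ x → ∃ λ e → (E e ≡ true) × R x x e
    right-unique : ∀ x y e → E e ≡ true → R x y e → x ≡ y

module Submission where

-- The convolution (f ∗ g)(x) is a supremum indexed by the triples R^x_{yz},
-- so everything reduces to three facts about suprema in a prequantale: a
-- bounded family attaining its bound has that bound as supremum; an empty
-- family has supremum 𝟘; and (classically) a supremum different from 𝟘 has
-- a summand different from 𝟘.  From these we derive an interface for ∗
-- (a summand lies below ∗; a bounded, attained convolution equals its bound;
-- a nonzero convolution has a nonzero summand) and for the two test
-- functions used: id_E, which is nonzero only on E, and the point function
-- δ_y v, which is v at y and 𝟘 elsewhere.  Then:
--  (1) id_E is a unit: each summand f y • id_E z is f x (when z ∈ E, since
--      then y = x) or 𝟘, and the relational unit of x attains f x;
--  (2) E is a set of relational units: testing the unit law on δ_x u shows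
--      that some nonzero summand exists (existence of units), and on δ_y u
--      that a summand u • u = u forces x = y (uniqueness);
--  (3) u is a unit of •: testing on the constant function a at any point of
--      X gives a = ⋁ (a • id_E z), whence a = 𝟘 or a = a • u.

open import Defs
open import Level using (Level)
open import Axiom.ExcludedMiddle using (ExcludedMiddle)
open import Axiom.DoubleNegationElimination using (DoubleNegationElimination; em⇒dne)
open import Data.Empty using (⊥-elim)
open import Data.Bool using (Bool; true; false)
open import Data.Product using (∃; _×_; _,_; proj₁; proj₂)
open import Relation.Nullary using (¬_; yes; no)
open import Relation.Binary.PropositionalEquality
  using (_≡_; refl; sym; trans; cong; cong₂; subst)
open import Relation.Binary.Bundles using (Poset)
open import Relation.Binary.Structures using (IsPartialOrder)
import Relation.Binary.Reasoning.PartialOrder as PosetReasoning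

module PrequantaleFacts {ℓ : Level} (Q : Prequantale ℓ) where
  open Prequantale Q public
  open IsPartialOrder isPartialOrder public
    using (antisym; reflexive) renaming (trans to ≤-trans)

  poset : Poset ℓ ℓ ℓ
  poset = record { isPartialOrder = isPartialOrder }

  open PosetReasoning poset public

  𝟘-least : ∀ b → 𝟘 ≤ b
  𝟘-least b = ⋁-least _ b (λ ())

  ≤𝟘⇒≡𝟘 : ∀ {a} → a ≤ 𝟘 → a ≡ 𝟘
  ≤𝟘⇒≡𝟘 {a} a≤𝟘 = antisym a≤𝟘 (𝟘-least a)

  ⋁-empty : {I : Set ℓ} (f : I → Carrier) → ¬ I → ⋁ f ≡ 𝟘
  ⋁-empty f ¬i = ≤𝟘⇒≡𝟘 (⋁-least f 𝟘 (λ i → ⊥-elim (¬i i)))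

  ⋁-attained : {I : Set ℓ} (f : I → Carrier) {b : Carrier} →
               (∀ i → f i ≤ b) → (i : I) → f i ≡ b → ⋁ f ≡ b
  ⋁-attained f {b} bound i fi≡b =
    antisym (⋁-least f b bound) (≤-trans (reflexive (sym fi≡b)) (⋁-upper f i))

  ⋁-support : DoubleNegationElimination ℓ → {I : Set ℓ} (f : I → Carrier) →
              ¬ ⋁ f ≡ 𝟘 → ∃ λ i → ¬ f i ≡ 𝟘
  ⋁-support dne f ⋁f≢𝟘 = dne λ noSupport →
    ⋁f≢𝟘 (≤𝟘⇒≡𝟘 (⋁-least f 𝟘 λ i →
      reflexive (dne λ fi≢𝟘 → noSupport (i , fi≢𝟘))))

  -- 𝟘 is absorbing for •, since • preserves the empty supremum.
  𝟘-•ˡ : ∀ b → 𝟘 • b ≡ 𝟘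
  𝟘-•ˡ b = trans (•-⋁ˡ _ b) (⋁-empty _ (λ ()))

  𝟘-•ʳ : ∀ a → a • 𝟘 ≡ 𝟘
  𝟘-•ʳ a = trans (•-⋁ʳ a _) (⋁-empty _ (λ ()))

  above-nonzero : ∀ {a b} → a ≤ b → ¬ a ≡ 𝟘 → ¬ b ≡ 𝟘
  above-nonzero a≤b a≢𝟘 b≡𝟘 = a≢𝟘 (≤𝟘⇒≡𝟘 (≤-trans a≤b (reflexive b≡𝟘)))

  •-nonzero : ∀ {a b} → ¬ a • b ≡ 𝟘 → ¬ a ≡ 𝟘 × ¬ b ≡ 𝟘
  •-nonzero {a} {b} ab≢𝟘 =
    (λ { refl → ab≢𝟘 (𝟘-•ˡ b) }) , (λ { refl → ab≢𝟘 (𝟘-•ʳ a) })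

  δ : {X : Set ℓ} → X → Carrier → X → Carrier
  δ y v z = ⋁ {z ≡ y} (λ _ → v)

  δ-at : {X : Set ℓ} (y : X) (v : Carrier) → δ y v y ≡ v
  δ-at y v = ⋁-attained _ (λ _ → reflexive refl) refl refl

  δ-nonzero : DoubleNegationElimination ℓ → {X : Set ℓ} {y z : X} {v : Carrier} →
              ¬ δ y v z ≡ 𝟘 → z ≡ y
  δ-nonzero dne δ≢𝟘 = dne (λ z≢y → δ≢𝟘 (⋁-empty _ z≢y))

  idE-on : {X : Set ℓ} (E : X → Bool) (u : Carrier) {e : X} →
           E e ≡ true → idE Q E u e ≡ u
  idE-on E u Ee rewrite Ee = refl

  idE-nonzero : {X : Set ℓ} (E : X → Bool) (u : Carrier) {y : X} →
                ¬ idE Q E u y ≡ 𝟘 → E y ≡ true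
  idE-nonzero E u {y} idE≢𝟘 with E y
  ... | true  = refl
  ... | false = ⊥-elim (idE≢𝟘 refl)

module ConvolutionFacts {ℓ : Level} (Q : Prequantale ℓ)
                        {X : Set ℓ} (R : X → X → X → Set ℓ) where
  open PrequantaleFacts Q

  _∗_ : (X → Carrier) → (X → Carrier) → X → Carrier
  _∗_ = conv Q R

  ∗-upper : (f g : X → Carrier) {x y z : X} → R x y z → (f y • g z) ≤ (f ∗ g) x
  ∗-upper f g r = ⋁-upper _ (_ , r)

  ∗-attained : (f g : X → Carrier) {x : X} {b : Carrier} →
               (∀ y z → R x y z → (f y • g z) ≤ b) →
               ∀ {y z} → R x y z → f y • g z ≡ b → (f ∗ g) x ≡ b
  ∗-attained f g bound r = ⋁-attained _ (λ { ((y , z) , r′) → bound y z r′ }) (_ , r)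

  ∗-support : DoubleNegationElimination ℓ → (f g : X → Carrier) {x : X} →
              ¬ (f ∗ g) x ≡ 𝟘 →
              ∃ λ y → ∃ λ z → R x y z × ¬ f y • g z ≡ 𝟘
  ∗-support dne f g ∗≢𝟘 with ⋁-support dne _ ∗≢𝟘
  ... | ((y , z) , r) , summand≢𝟘 = y , z , r , summand≢𝟘

-- (1) If E is a set of relational units and u a unit of •, then id_E is a
-- unit of ∗: a summand f y • id_E z of (f ∗ id_E)(x) is 𝟘 unless z ∈ E, in
-- which case y = x and the summand is f x; the unit of x attains f x.
module UnitFromRelationalUnits {ℓ : Level} (Q : Prequantale ℓ)
    {X : Set ℓ} (R : X → X → X → Set ℓ) (E : X → Bool)
    (u : Prequantale.Carrier Q)
    (units : RelationalUnits R E) (unit : IsTwoSidedUnit Q u) where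
  open PrequantaleFacts Q
  open ConvolutionFacts Q R
  open RelationalUnits units

  ι : X → Carrier
  ι = idE Q E u

  summand-≤ʳ : (f : X → Carrier) {x : X} → ∀ y z → R x y z → (f y • ι z) ≤ f x
  summand-≤ʳ f {x} y z r with E z in Ez
  ... | true rewrite right-unique x y z Ez r = reflexive (proj₂ (unit (f y)))
  ... | false = ≤-trans (reflexive (𝟘-•ʳ (f y))) (𝟘-least (f x))

  summand-≤ˡ : (f : X → Carrier) {x : X} → ∀ y z → R x y z → (ι y • f z) ≤ f x
  summand-≤ˡ f {x} y z r with E y in Ey
  ... | true rewrite left-unique x z y Ey r = reflexive (proj₁ (unit (f z)))
  ... | false = ≤-trans (reflexive (𝟘-•ˡ (f z))) (𝟘-least (f x))

  ∗-unitʳ : ∀ f x → (f ∗ ι) x ≡ f x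
  ∗-unitʳ f x with right-exists x
  ... | e , Ee , r = ∗-attained f ι (summand-≤ʳ f) r
                       (trans (cong (f x •_) (idE-on E u Ee)) (proj₂ (unit (f x))))

  ∗-unitˡ : ∀ f x → (ι ∗ f) x ≡ f x
  ∗-unitˡ f x with left-exists x
  ... | e , Ee , r = ∗-attained ι f (summand-≤ˡ f) r
                       (trans (cong (_• f x) (idE-on E u Ee)) (proj₁ (unit (f x))))

  isConvUnit : IsConvUnit Q R ι
  isConvUnit f x = ∗-unitʳ f x , ∗-unitˡ f x

-- Existence: (id_E ∗ δ_x u)(x) = u ≠ 𝟘, so some summand
-- id_E e • δ_x u z with R^x_{ez} is nonzero, forcing e ∈ E and z = x.
-- Uniqueness: for e ∈ E and R^x_{ey}, the summand id_E e • δ_y u y = u lies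
-- below (id_E ∗ δ_y u)(x) = δ_y u x, which is therefore nonzero, so x = y.
module RelationalUnitsFromUnit {ℓ : Level} (dne : DoubleNegationElimination ℓ)
    (Q : Prequantale ℓ) {X : Set ℓ} (R : X → X → X → Set ℓ) (E : X → Bool)
    (u : Prequantale.Carrier Q) (unit : IsTwoSidedUnit Q u)
    (u≢𝟘 : ¬ u ≡ Prequantale.𝟘 Q) (convUnit : IsConvUnit Q R (idE Q E u)) where
  open PrequantaleFacts Q
  open ConvolutionFacts Q R

  ι : X → Carrier
  ι = idE Q E u

  δ-at-nonzero : (x : X) → ¬ δ x u x ≡ 𝟘
  δ-at-nonzero x eq = u≢𝟘 (trans (sym (δ-at x u)) eq)

  left-exists : ∀ x → ∃ λ e → (E e ≡ true) × R x e x
  left-exists x with ∗-support dne ι (δ x u)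
                       (λ eq → δ-at-nonzero x (trans (sym (proj₂ (convUnit (δ x u) x))) eq))
  ... | e , z , r , summand≢𝟘 =
    e , idE-nonzero E u (proj₁ (•-nonzero summand≢𝟘))
      , subst (R x e) (δ-nonzero dne (proj₂ (•-nonzero summand≢𝟘))) r

  right-exists : ∀ x → ∃ λ e → (E e ≡ true) × R x x e
  right-exists x with ∗-support dne (δ x u) ι
                        (λ eq → δ-at-nonzero x (trans (sym (proj₁ (convUnit (δ x u) x))) eq))
  ... | y , e , r , summand≢𝟘 =
    e , idE-nonzero E u (proj₂ (•-nonzero summand≢𝟘))
      , subst (λ w → R x w e) (δ-nonzero dne (proj₁ (•-nonzero summand≢𝟘))) r

  left-unique : ∀ x y e → E e ≡ true → R x e y → x ≡ y
  left-unique x y e Ee r = δ-nonzero dne (above-nonzero u≤δ u≢𝟘)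
    where
    u≤δ : u ≤ δ y u x
    u≤δ = begin
      u                 ≡⟨ proj₁ (unit u) ⟨
      u • u             ≡⟨ cong₂ _•_ (idE-on E u Ee) (δ-at y u) ⟨
      ι e • δ y u y     ≤⟨ ∗-upper ι (δ y u) r ⟩
      (ι ∗ δ y u) x     ≡⟨ proj₂ (convUnit (δ y u) x) ⟩
      δ y u x           ∎

  right-unique : ∀ x y e → E e ≡ true → R x y e → x ≡ y
  right-unique x y e Ee r = δ-nonzero dne (above-nonzero u≤δ u≢𝟘)
    where
    u≤δ : u ≤ δ y u x
    u≤δ = begin
      u                 ≡⟨ proj₁ (unit u) ⟨
      u • u             ≡⟨ cong₂ _•_ (δ-at y u) (idE-on E u Ee) ⟨
      δ y u y • ι e     ≤⟨ ∗-upper (δ y u) ι r ⟩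
      (δ y u ∗ ι) x     ≡⟨ proj₁ (convUnit (δ y u) x) ⟩
      δ y u x           ∎

  relationalUnits : RelationalUnits R E
  relationalUnits = record
    { left-exists  = left-exists
    ; left-unique  = left-unique
    ; right-exists = right-exists
    ; right-unique = right-unique
    }

-- Testing the unit law on the constant function a at x₀ gives
-- a = ⋁ {id_E y • a | R^{x₀}_{yz}}.  Each summand is u • a or 𝟘, so either
-- a = 𝟘 (and u • a = 𝟘 = a), or some summand is nonzero, hence equals u • a
-- and is attained, so a = u • a.
module UnitFromConvUnit {ℓ : Level} (em : ExcludedMiddle ℓ)
    (Q : Prequantale ℓ) {X : Set ℓ} (R : X → X → X → Set ℓ) (E : X → Bool)
    (u : Prequantale.Carrier Q) (x₀ : X)
    (convUnit : IsConvUnit Q R (idE Q E u)) where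
  open PrequantaleFacts Q
  open ConvolutionFacts Q R

  ι : X → Carrier
  ι = idE Q E u

  constant : Carrier → X → Carrier
  constant a _ = a

  summand-≤ˡ : ∀ a y → (ι y • a) ≤ (u • a)
  summand-≤ˡ a y with E y
  ... | true  = reflexive refl
  ... | false = ≤-trans (reflexive (𝟘-•ˡ a)) (𝟘-least (u • a))

  summand-≤ʳ : ∀ a z → (a • ι z) ≤ (a • u)
  summand-≤ʳ a z with E z
  ... | true  = reflexive refl
  ... | false = ≤-trans (reflexive (𝟘-•ʳ a)) (𝟘-least (a • u))

  unitˡ : ∀ a → u • a ≡ a
  unitˡ a with em {a ≡ 𝟘}
  ... | yes refl = 𝟘-•ʳ u
  ... | no a≢𝟘 with ∗-support (em⇒dne em) ι (constant a)
                        (λ eq → a≢𝟘 (trans (sym (proj₂ (convUnit (constant a) x₀))) eq))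
  ... | y , _ , r , summand≢𝟘 = begin-equality
      u • a                     ≡⟨ ∗-attained ι (constant a) (λ y _ _ → summand-≤ˡ a y) r
                                     (cong (_• a) (idE-on E u Ey)) ⟨
      (ι ∗ constant a) x₀       ≡⟨ proj₂ (convUnit (constant a) x₀) ⟩
      a                         ∎
    where Ey = idE-nonzero E u (proj₁ (•-nonzero summand≢𝟘))

  unitʳ : ∀ a → a • u ≡ a
  unitʳ a with em {a ≡ 𝟘}
  ... | yes refl = 𝟘-•ˡ u
  ... | no a≢𝟘 with ∗-support (em⇒dne em) (constant a) ι
                        (λ eq → a≢𝟘 (trans (sym (proj₁ (convUnit (constant a) x₀))) eq))
  ... | _ , z , r , summand≢𝟘 = begin-equality
      a • u                     ≡⟨ ∗-attained (constant a) ι (λ _ z _ → summand-≤ʳ a z) r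
                                     (cong (a •_) (idE-on E u Ez)) ⟨
      (constant a ∗ ι) x₀       ≡⟨ proj₁ (convUnit (constant a) x₀) ⟩
      a                         ∎
    where Ez = idE-nonzero E u (proj₂ (•-nonzero summand≢𝟘))

  isTwoSidedUnit : IsTwoSidedUnit Q u
  isTwoSidedUnit a = unitˡ a , unitʳ a

proposition4p1 : {ℓ : Level} → ExcludedMiddle ℓ →
    (X : Set ℓ) (R : X → X → X → Set ℓ) (E : X → Bool)
    (Q : Prequantale ℓ) (u : Prequantale.Carrier Q) →
    ((RelationalUnits R E × IsTwoSidedUnit Q u) →
       IsConvUnit Q R (idE Q E u))
    × ((IsTwoSidedUnit Q u × ¬ (u ≡ Prequantale.𝟘 Q) × IsConvUnit Q R (idE Q E u)) →
       RelationalUnits R E)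
    × (((∃ λ x → E x ≡ true) × IsConvUnit Q R (idE Q E u)) →
       IsTwoSidedUnit Q u)
proposition4p1 em X R E Q u =
    (λ (units , unit) →
       UnitFromRelationalUnits.isConvUnit Q R E u units unit)
  , (λ (unit , u≢𝟘 , convUnit) →
       RelationalUnitsFromUnit.relationalUnits (em⇒dne em) Q R E u unit u≢𝟘 convUnit)
  , (λ ((x₀ , _) , convUnit) →
       UnitFromConvUnit.isTwoSidedUnit em Q R E u x₀ convUnit)
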